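{- If $G$ and $H$ are finite connected graphs, then $\sigma(G \circ H) \leq \sigma(G)\,|V(H)| + \sigma(H)$, where $G \circ H$ is the lexicographic product.
   Context: Surrounding Cops and Robbers on a finite simple graph $G$ with $k \geq 1$ cops and one robber: the cops first choose starting vertices (several cops may share a vertex), then the robber chooses a starting vertex not occupied by a cop, and thereafter the cops and the robber alternate moves, the cops moving first. In a move, each player may move to an adjacent vertex or stay put; the robber may never move to, or remain on, a vertex occupied by a cop, so if a cop moves onto the robber's vertex the robber is compelled to move to a neighbouring vertex not occupied by a cop. The cops win if at any time every neighbour of the robber's vertex is occupied by a cop; the robber wins if he avoids this forever. Play is with perfect information. The surrounding cop number $\sigma(G)$ is the least number of cops for which the cops have a winning strategy. The lexicographic product $G \circ H$ has vertex set $V(G)\times V(H)$, with $(g,h)$ adjacent to $(g',h')$ iff $gg' \in E(G)$, or $g = g'$ and $hh' \in E(H)$. -}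

module Defs where

open import Data.Nat using (ℕ; _*_; _+_; _≤_; _<_)
open import Data.Fin using (Fin; remQuot)
open import Data.Product using (Σ; ∃; _×_; _,_; proj₁; proj₂)
open import Data.Sum using (_⊎_)
open import Relation.Nullary using (¬_; Dec)
open import Relation.Nullary.Decidable using (_⊎-dec_; _×-dec_)
open import Data.Fin using (_≟_)
open import Data.Sum using (inj₁; inj₂)
open import Relation.Binary.PropositionalEquality using (refl)
open import Relation.Binary.PropositionalEquality using (_≡_; _≢_)

record Graph : Set₁ where
  field
    n      : ℕ
    Adj    : Fin n → Fin n → Set
    adj?   : ∀ u v → Dec (Adj u v)
    sym    : ∀ {u v} → Adj u v → Adj v u
    irrefl : ∀ {u} → ¬ Adj u u
open Graph public

data Reach (G : Graph) : Fin (n G) → Fin (n G) → Set where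
  here : ∀ {u} → Reach G u u
  step : ∀ {u v w} → Adj G u v → Reach G v w → Reach G u w

Connected : Graph → Set
Connected G = Fin (n G) × (∀ u v → Reach G u v)

-- Lexicographic product G ∘ H.  The vertex x : Fin (n G * n H) stands for
-- the pair remQuot (n H) x = (g , h) ∈ V(G) × V(H) (a bijection, inverse combine).
module _ (G H : Graph) where
  PairAdj : Fin (n G) × Fin (n H) → Fin (n G) × Fin (n H) → Set
  PairAdj (g , h) (g' , h') = Adj G g g' ⊎ (g ≡ g' × Adj H h h')

  pairAdj? : ∀ p q → Dec (PairAdj p q)
  pairAdj? (g , h) (g' , h') = adj? G g g' ⊎-dec ((g ≟ g') ×-dec adj? H h h')

  pairSym : ∀ {p q} → PairAdj p q → PairAdj q p
  pairSym {_ , _} {_ , _} (inj₁ a) = inj₁ (sym G a)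
  pairSym {_ , _} {_ , _} (inj₂ (refl , a)) = inj₂ (refl , sym H a)

  pairIrrefl : ∀ {p} → ¬ PairAdj p p
  pairIrrefl {_ , _} (inj₁ a) = irrefl G a
  pairIrrefl {_ , _} (inj₂ (_ , a)) = irrefl H a

  split : Fin (n G * n H) → Fin (n G) × Fin (n H)
  split = remQuot {n G} (n H)

_∘ₗ_ : Graph → Graph → Graph
G ∘ₗ H = record
  { n = n G * n H
  ; Adj = λ x y → PairAdj G H (split G H x) (split G H y)
  ; adj? = λ x y → pairAdj? G H (split G H x) (split G H y)
  ; sym = pairSym G H
  ; irrefl = pairIrrefl G H
  }

module Game (G : Graph) (k : ℕ) where
  V = Fin (n G)
  Cops = Fin k → V

  Occupied : Cops → V → Set
  Occupied cs v = Σ (Fin k) λ i → cs i ≡ v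

  Surrounded : Cops → V → Set
  Surrounded cs r = ∀ v → Adj G r v → Occupied cs v

  Move : V → V → Set
  Move u v = u ≡ v ⊎ Adj G u v

  -- Positions from which the cops have a winning strategy (cops win in finitely
  -- many moves whatever the robber does; inductive = the game is won at a finite time).
  mutual
    -- cops to move; robber at r (not on a cop)
    data CopWinC (cs : Cops) (r : V) : Set where
      surroundedC : Surrounded cs r → CopWinC cs r
      copMove : (cs' : Cops) → (∀ i → Move (cs i) (cs' i)) → CopWinR cs' r → CopWinC cs r

    -- robber to move; robber at r (a cop may just have moved onto r)
    data CopWinR (cs : Cops) (r : V) : Set where
      surroundedR : Surrounded cs r → CopWinR cs r
      robberMoves : (∀ r' → Move r r' → ¬ Occupied cs r' → CopWinC cs r') → CopWinR cs r

  -- cops choose start vertices, then robber chooses an unoccupied start vertex, cops move first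
  CopsWin : Set
  CopsWin = Σ Cops λ cs → ∀ r → ¬ Occupied cs r → CopWinC cs r

CopsWin : Graph → ℕ → Set
CopsWin G k = Game.CopsWin G k

IsSurroundingCopNumber : Graph → ℕ → Set
IsSurroundingCopNumber G s = (1 ≤ s) × CopsWin G s × (∀ k → 1 ≤ k → k < s → ¬ CopsWin G k)

module Submission where

-- Each G-cop is replaced by a "shadow" of |V(H)| cops occupying its
-- whole fibre {g} × V(H); the shadows play the G-strategy against the G-coordinate of the
-- robber, while t free cops wait.  Once the shadows surround the robber's G-coordinate g,
-- every G-neighbour fibre is full, so the robber is confined to the fibre {g} × V(H) ≅ H.
-- The free cops then walk (one at a time, G ∘ H being connected) to the starting
-- positions of the H-strategy inside that fibre and play it there; an H-surrounding
-- inside the fibre, together with the shadows, surrounds the robber in G ∘ H.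
--
-- The theorem asks for the exact surrounding cop
-- number of G ∘ H, which exists constructively because the game on a finite graph is
-- decidable: a bounded version of the winning predicate is decidable, increasing in the
-- bound, and stabilises on the finite set of positions, so it coincides with the
-- inductive winning predicate.  The least k ≥ 1 with a cop win is then found by search.

open import Defs hiding (sym)
open import Data.Nat using (ℕ; zero; suc; _*_; _+_; _≤_; _<_; _≤′_; ≤′-refl; ≤′-step; z≤n; s≤s; _≤?_)
open import Data.Nat.Properties using (≤-refl; ≤-trans; m≤n⇒m≤1+n; m≤n⇒m<n∨m≡n; m≤n+m; <⇒≤; ≤⇒≤′)
open import Data.Fin using (Fin; zero; suc; _≟_; combine; remQuot; splitAt; _↑ˡ_; _↑ʳ_)
open import Data.Fin.Properties using (any?; all?; remQuot-combine; combine-remQuot; splitAt-↑ˡ; splitAt-↑ʳ)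
open import Data.Product using (Σ; _×_; _,_; proj₁; proj₂)
open import Data.Sum using (_⊎_; inj₁; inj₂; [_,_]′)
open import Data.Empty using (⊥-elim)
open import Data.List using (List; []; _∷_; cartesianProductWith; cartesianProduct; allFin)
open import Data.List.Relation.Unary.Any using (here; there; satisfied)
import Data.List.Relation.Unary.Any as Any
open import Data.List.Relation.Unary.All using (All; []; _∷_)
import Data.List.Relation.Unary.All as All
open import Data.List.Membership.Propositional using (_∈_; _∉_; lose)
open import Data.List.Membership.Propositional.Properties using (∈-cartesianProductWith⁺; ∈-cartesianProduct⁺; ∈-allFin)
open import Data.Vec.Functional using (Vector; updateAt) renaming (_∷_ to _◂_)
open import Data.Vec.Functional.Properties using (updateAt-updates; updateAt-minimal; updateAt-id-local)
open import Function using (const)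
open import Relation.Nullary using (¬_; Dec; yes; no)
open import Relation.Nullary.Decidable using (_⊎-dec_; _×-dec_; _→-dec_; ¬?)
open import Relation.Binary.PropositionalEquality using (_≡_; _≗_; refl; sym; trans; cong; subst; subst₂; module ≡-Reasoning)

Minimal : (ℕ → Set) → ℕ → Set
Minimal P u = P u × (∀ k → k < u → ¬ P k)

module _ {P : ℕ → Set} (P? : ∀ k → Dec (P k)) where

  searchUpTo : ∀ K → (Σ ℕ λ u → u ≤ K × Minimal P u) ⊎ (∀ k → k ≤ K → ¬ P k)
  searchUpTo zero with P? zero
  ... | yes p = inj₁ (zero , z≤n , p , λ _ ())
  ... | no ¬p = inj₂ λ { zero _ → ¬p }
  searchUpTo (suc K) with searchUpTo K
  ... | inj₁ (u , u≤K , min) = inj₁ (u , m≤n⇒m≤1+n u≤K , min)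
  ... | inj₂ none with P? (suc K)
  ...   | yes p = inj₁ (suc K , ≤-refl , p , λ { k (s≤s k≤K) → none k k≤K })
  ...   | no ¬p = inj₂ λ k k≤1+K → [ (λ { (s≤s k≤K) → none k k≤K }) , (λ { refl → ¬p }) ]′
                                     (m≤n⇒m<n∨m≡n k≤1+K)

  leastWitness : ∀ K → P K → Σ ℕ λ u → u ≤ K × Minimal P u
  leastWitness K pK with searchUpTo K
  ... | inj₁ found = found
  ... | inj₂ none = ⊥-elim (none K ≤-refl pK)

module Stabilisation {X : Set} (P : ℕ → X → Set) (P? : ∀ m x → Dec (P m x))
                     (increasing : ∀ m x → P m x → P (suc m) x) where

  upward : ∀ {a b} x → a ≤ b → P a x → P b x
  upward x a≤b = go (≤⇒≤′ a≤b)
    where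
      go : ∀ {a b} → a ≤′ b → P a x → P b x
      go ≤′-refl p = p
      go (≤′-step a≤b) p = increasing _ x (go a≤b p)

  StableAt : ℕ → X → Set
  StableAt m x = P (suc m) x → P m x

  -- If x is not stable at m₁ it enters the chain at m₁ + 1 and stays, so stabilising
  -- the tail of the list beyond m₁ + 1 also stabilises x.
  stabilises : ∀ xs m₀ → Σ ℕ λ m → m₀ ≤ m × All (StableAt m) xs
  stabilises [] m₀ = m₀ , ≤-refl , []
  stabilises (x ∷ xs) m₀ with stabilises xs m₀
  ... | m₁ , m₀≤m₁ , stable₁ with P? m₁ x | P? (suc m₁) x
  ...   | yes p | _ = m₁ , m₀≤m₁ , (λ _ → p) ∷ stable₁
  ...   | no _ | no ¬q = m₁ , m₀≤m₁ , (λ q → ⊥-elim (¬q q)) ∷ stable₁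
  ...   | no _ | yes q with stabilises xs (suc m₁)
  ...     | m₂ , m₁<m₂ , stable₂ =
              m₂ , ≤-trans m₀≤m₁ (<⇒≤ m₁<m₂)
                 , (λ _ → upward x m₁<m₂ q) ∷ stable₂

-- The finitely many functions Fin m → Fin N, listed up to pointwise equality.  Since the
-- game treats cop placements as functions, predicates on them are only known to respect ≗.
module FunctionEnumeration (N : ℕ) where

  allFunctions : ∀ m → List (Vector (Fin N) m)
  allFunctions zero = (λ ()) ∷ []
  allFunctions (suc m) = cartesianProductWith _◂_ (allFin N) (allFunctions m)

  listed : ∀ {m} (f : Vector (Fin N) m) → Σ (Vector (Fin N) m) λ g → g ∈ allFunctions m × f ≗ g
  listed {zero} f = (λ ()) , here refl , λ ()
  listed {suc m} f with listed (λ i → f (suc i))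
  ... | g , g∈ , f≗g = f zero ◂ g , ∈-cartesianProductWith⁺ _◂_ (∈-allFin (f zero)) g∈
                      , λ { zero → refl ; (suc i) → f≗g i }

  RespectsPointwise : ∀ {m} → (Vector (Fin N) m → Set) → Set
  RespectsPointwise P = ∀ {f g} → f ≗ g → P f → P g

  anyFunction? : ∀ {m} (P : Vector (Fin N) m → Set) → (∀ f → Dec (P f)) →
                 RespectsPointwise P → Dec (Σ (Vector (Fin N) m) P)
  anyFunction? {m} P P? resp with Any.any? P? (allFunctions m)
  ... | yes found = yes (satisfied found)
  ... | no none = no λ (f , pf) → let (g , g∈ , f≗g) = listed f in none (lose g∈ (resp f≗g pf))

module Decision (G : Graph) (k : ℕ) where
  open Game G k hiding (CopsWin)
  open FunctionEnumeration (n G)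

  occupied? : ∀ cs v → Dec (Occupied cs v)
  occupied? cs v = any? (λ i → cs i ≟ v)

  surrounded? : ∀ cs r → Dec (Surrounded cs r)
  surrounded? cs r = all? (λ v → adj? G r v →-dec occupied? cs v)

  move? : ∀ u v → Dec (Move u v)
  move? u v = (u ≟ v) ⊎-dec adj? G u v

  mutual
    WithinC : ℕ → Cops → V → Set
    WithinC zero cs r = Surrounded cs r
    WithinC (suc m) cs r = Surrounded cs r ⊎ Σ Cops λ cs' → (∀ i → Move (cs i) (cs' i)) × WithinR m cs' r

    WithinR : ℕ → Cops → V → Set
    WithinR m cs r = Surrounded cs r ⊎ (∀ r' → Move r r' → ¬ Occupied cs r' → WithinC m cs r')

  surrounded⇒within : ∀ m {cs r} → Surrounded cs r → WithinC m cs r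
  surrounded⇒within zero sur = sur
  surrounded⇒within (suc m) sur = inj₁ sur

  occupied-resp : ∀ {cs cs' v} → cs ≗ cs' → Occupied cs v → Occupied cs' v
  occupied-resp cs≗cs' (i , csi≡v) = i , trans (sym (cs≗cs' i)) csi≡v

  surrounded-resp : ∀ {cs cs' r} → cs ≗ cs' → Surrounded cs r → Surrounded cs' r
  surrounded-resp cs≗cs' sur v adj = occupied-resp cs≗cs' (sur v adj)

  mutual
    withinC-resp : ∀ m {cs cs' r} → cs ≗ cs' → WithinC m cs r → WithinC m cs' r
    withinC-resp zero e sur = surrounded-resp e sur
    withinC-resp (suc m) e (inj₁ sur) = inj₁ (surrounded-resp e sur)
    withinC-resp (suc m) e (inj₂ (cs'' , moves , w)) =
      inj₂ (cs'' , (λ i → subst (λ c → Move c (cs'' i)) (e i) (moves i)) , w)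

    withinR-resp : ∀ m {cs cs' r} → cs ≗ cs' → WithinR m cs r → WithinR m cs' r
    withinR-resp m e (inj₁ sur) = inj₁ (surrounded-resp e sur)
    withinR-resp m e (inj₂ w) = inj₂ λ r' mv free →
      withinC-resp m e (w r' mv (λ o → free (occupied-resp e o)))

  mutual
    withinC? : ∀ m cs r → Dec (WithinC m cs r)
    withinC? zero cs r = surrounded? cs r
    withinC? (suc m) cs r =
      surrounded? cs r ⊎-dec
      anyFunction? _ (λ cs' → all? (λ i → move? (cs i) (cs' i)) ×-dec withinR? m cs' r)
        (λ e (moves , w) → (λ i → subst (Move (cs i)) (e i) (moves i)) , withinR-resp m e w)

    withinR? : ∀ m cs r → Dec (WithinR m cs r)
    withinR? m cs r = surrounded? cs r ⊎-dec all? (λ r' → move? r r' →-dec (¬? (occupied? cs r') →-dec withinC? m cs r'))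

  mutual
    withinC-sound : ∀ m {cs r} → WithinC m cs r → CopWinC cs r
    withinC-sound zero sur = surroundedC sur
    withinC-sound (suc m) (inj₁ sur) = surroundedC sur
    withinC-sound (suc m) (inj₂ (cs' , moves , w)) = copMove cs' moves (withinR-sound m w)

    withinR-sound : ∀ m {cs r} → WithinR m cs r → CopWinR cs r
    withinR-sound m (inj₁ sur) = surroundedR sur
    withinR-sound m (inj₂ w) = robberMoves λ r' mv free → withinC-sound m (w r' mv free)

  mutual
    withinC-step : ∀ m {cs r} → WithinC m cs r → WithinC (suc m) cs r
    withinC-step zero sur = inj₁ sur
    withinC-step (suc m) (inj₁ sur) = inj₁ sur
    withinC-step (suc m) (inj₂ (cs' , moves , w)) = inj₂ (cs' , moves , withinR-step m w)

    withinR-step : ∀ m {cs r} → WithinR m cs r → WithinR (suc m) cs r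
    withinR-step m (inj₁ sur) = inj₁ sur
    withinR-step m (inj₂ w) = inj₂ λ r' mv free → withinC-step m (w r' mv free)

  -- The chain WithinC 0 ⊆ WithinC 1 ⊆ … stabilises on the finite set of positions at
  -- some bound M; beyond M no further winning positions appear.
  positions : List (Cops × V)
  positions = cartesianProduct (allFunctions k) (allFin (n G))

  open Stabilisation (λ m (p : Cops × V) → WithinC m (proj₁ p) (proj₂ p))
                     (λ m p → withinC? m (proj₁ p) (proj₂ p)) (λ m p → withinC-step m)

  M : ℕ
  M = proj₁ (stabilises positions 0)

  -- Every position is listed up to ≗, so stability at M extends to all positions.
  stableAtM : ∀ cs r → WithinC (suc M) cs r → WithinC M cs r
  stableAtM cs r w with listed cs
  ... | cs' , cs'∈ , cs≗cs' = withinC-resp M (λ i → sym (cs≗cs' i))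
        (All.lookup (proj₂ (proj₂ (stabilises positions 0))) (∈-cartesianProduct⁺ cs'∈ (∈-allFin r))
                    (withinC-resp (suc M) cs≗cs' w))

  mutual
    withinC-complete : ∀ {cs r} → CopWinC cs r → WithinC M cs r
    withinC-complete (surroundedC sur) = surrounded⇒within M sur
    withinC-complete {cs} {r} (copMove cs' moves w) = stableAtM cs r (inj₂ (cs' , moves , withinR-complete w))

    withinR-complete : ∀ {cs r} → CopWinR cs r → WithinR M cs r
    withinR-complete (surroundedR sur) = inj₁ sur
    withinR-complete (robberMoves w) = inj₂ λ r' mv free → withinC-complete (w r' mv free)

  copsWin? : Dec (CopsWin G k)
  copsWin? with anyFunction? (λ cs → ∀ r → ¬ Occupied cs r → WithinC M cs r)
                  (λ cs → all? (λ r → ¬? (occupied? cs r) →-dec withinC? M cs r))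
                  (λ e w r free → withinC-resp M e (w r (λ o → free (occupied-resp e o))))
  ... | yes (cs , w) = yes (cs , λ r free → withinC-sound M (w r free))
  ... | no ¬w = no λ (cs , w) → ¬w (cs , λ r free → withinC-complete (w r free))

module LexicographicProduct (G H : Graph) where

  VG VH V : Set
  VG = Fin (n G)
  VH = Fin (n H)
  V = Fin (n G * n H)

  vertex : VG → VH → V
  vertex = combine

  πG : V → VG
  πG x = proj₁ (split G H x)

  πH : V → VH
  πH x = proj₂ (split G H x)

  split-vertex : ∀ g h → split G H (vertex g h) ≡ (g , h)
  split-vertex = remQuot-combine

  vertex-split : ∀ x → vertex (πG x) (πH x) ≡ x
  vertex-split = combine-remQuot {n G} (n H)

  adj-vertex : ∀ {g h g' h'} → PairAdj G H (g , h) (g' , h') → Adj (G ∘ₗ H) (vertex g h) (vertex g' h')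
  adj-vertex {g} {h} {g'} {h'} p =
    subst₂ (PairAdj G H) (sym (split-vertex g h)) (sym (split-vertex g' h')) p

  adj-split : ∀ {g h y} → Adj (G ∘ₗ H) (vertex g h) y → PairAdj G H (g , h) (split G H y)
  adj-split {g} {h} {y} a = subst (λ q → PairAdj G H q (split G H y)) (split-vertex g h) a

  reach-trans : ∀ {x y z} → Reach (G ∘ₗ H) x y → Reach (G ∘ₗ H) y z → Reach (G ∘ₗ H) x z
  reach-trans here q = q
  reach-trans (step a p) q = step a (reach-trans p q)

  reach-alongG : ∀ {a b} h → Reach G a b → Reach (G ∘ₗ H) (vertex a h) (vertex b h)
  reach-alongG h here = here
  reach-alongG h (step a p) = step (adj-vertex (inj₁ a)) (reach-alongG h p)

  reach-alongH : ∀ {a b} g → Reach H a b → Reach (G ∘ₗ H) (vertex g a) (vertex g b)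
  reach-alongH g here = here
  reach-alongH g (step a p) = step (adj-vertex (inj₂ (refl , a))) (reach-alongH g p)

  -- G ∘ H is connected when G and H are: go along a layer, then along a fibre.
  product-connected : (∀ u v → Reach G u v) → (∀ u v → Reach H u v) → ∀ x y → Reach (G ∘ₗ H) x y
  product-connected connG connH x y =
    subst₂ (Reach (G ∘ₗ H)) (vertex-split x) (vertex-split y)
      (reach-trans (reach-alongG (πH x) (connG (πG x) (πG y))) (reach-alongH (πG y) (connH (πH x) (πH y))))

module Strategy (G H : Graph) (s t : ℕ) where
  open LexicographicProduct G H

  K : ℕ
  K = s * n H + t

  module GG = Game G s
  module HG = Game H t
  module PG = Game (G ∘ₗ H) K

  liftMoveG : ∀ {a b} h → GG.Move a b → PG.Move (vertex a h) (vertex b h)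
  liftMoveG h (inj₁ refl) = inj₁ refl
  liftMoveG h (inj₂ a) = inj₂ (adj-vertex (inj₁ a))

  liftMoveH : ∀ g {a b} → HG.Move a b → PG.Move (vertex g a) (vertex g b)
  liftMoveH g (inj₁ refl) = inj₁ refl
  liftMoveH g (inj₂ a) = inj₂ (adj-vertex (inj₂ (refl , a)))

  projectMove : ∀ {g h r'} → PG.Move (vertex g h) r' → GG.Move g (πG r')
  projectMove {g} {h} (inj₁ refl) = inj₁ (sym (cong proj₁ (split-vertex g h)))
  projectMove {g} {h} {r'} (inj₂ a) with adj-split {g} {h} {r'} a
  ... | inj₁ ag = inj₂ ag
  ... | inj₂ (g≡ , _) = inj₁ g≡

  FreeCops : Set
  FreeCops = Fin t → V

  -- The shadow of G-cops cg: cop (j , h) stands on (cg j , h), filling the fibre of cg j.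
  shadow : GG.Cops → Fin (s * n H) → V
  shadow cg a = vertex (cg (proj₁ (remQuot {s} (n H) a))) (proj₂ (remQuot {s} (n H) a))

  -- The first s·|V(H)| cops form the shadow of cg, the last t cops stand at fc.
  -- Kept opaque so that formation cg fc determines cg and fc during unification.
  opaque
    formation : GG.Cops → FreeCops → PG.Cops
    formation cg fc i = [ shadow cg , fc ]′ (splitAt (s * n H) i)

  opaque
    unfolding formation
    formation-moves : ∀ {cg cg' fc fc'} → (∀ j → GG.Move (cg j) (cg' j)) → (∀ i → PG.Move (fc i) (fc' i)) →
                      ∀ i → PG.Move (formation cg fc i) (formation cg' fc' i)
    formation-moves movesG movesF i with splitAt (s * n H) i
    ... | inj₁ a = liftMoveG _ (movesG _)
    ... | inj₂ b = movesF b

    shadow-occupies : ∀ {cg fc v} j → cg j ≡ πG v → PG.Occupied (formation cg fc) v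
    shadow-occupies {cg} {fc} {v} j cgj≡ = combine j (πH v) ↑ˡ t , (begin
        formation cg fc (combine j (πH v) ↑ˡ t)
      ≡⟨ cong [ shadow cg , fc ]′ (splitAt-↑ˡ (s * n H) (combine j (πH v)) t) ⟩
        shadow cg (combine j (πH v))
      ≡⟨ cong (λ p → vertex (cg (proj₁ p)) (proj₂ p)) (remQuot-combine j (πH v)) ⟩
        vertex (cg j) (πH v)
      ≡⟨ cong (λ g → vertex g (πH v)) cgj≡ ⟩
        vertex (πG v) (πH v)
      ≡⟨ vertex-split v ⟩
        v ∎)
      where open ≡-Reasoning

    free-occupies : ∀ {cg fc v} i → fc i ≡ v → PG.Occupied (formation cg fc) v
    free-occupies {cg} {fc} i fci≡ = (s * n H) ↑ʳ i , trans (cong [ shadow cg , fc ]′ (splitAt-↑ʳ (s * n H) t i)) fci≡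

  -- When the G-cops surround g, the robber at (g , h) cannot leave the fibre of g:
  -- every G-neighbouring fibre is filled by shadows.
  confined : ∀ {cg fc g h r'} → GG.Surrounded cg g → PG.Move (vertex g h) r' →
             ¬ PG.Occupied (formation cg fc) r' → Σ VH λ h' → r' ≡ vertex g h' × HG.Move h h'
  confined {h = h} surG (inj₁ refl) free = h , refl , inj₁ refl
  confined {cg} {fc} {g} {h} {r'} surG (inj₂ a) free with adj-split {g} {h} {r'} a
  ... | inj₁ ag = ⊥-elim (free (shadow-occupies (proj₁ (surG _ ag)) (proj₂ (surG _ ag))))
  ... | inj₂ (g≡ , ah) = πH r' , trans (sym (vertex-split r')) (cong (λ x → vertex x (πH r')) (sym g≡)) , inj₂ ah

  inFibre : VG → (Fin t → VH) → FreeCops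
  inFibre g hs i = vertex g (hs i)

  surrounded-in-fibre : ∀ {cg g hs h} → GG.Surrounded cg g → HG.Surrounded hs h →
                        PG.Surrounded (formation cg (inFibre g hs)) (vertex g h)
  surrounded-in-fibre {cg} {g} {hs} {h} surG surH v a with adj-split {g} {h} {v} a
  ... | inj₁ ag = shadow-occupies (proj₁ (surG _ ag)) (proj₂ (surG _ ag))
  ... | inj₂ (g≡ , ah) with surH _ ah
  ...   | i , hsi≡ = free-occupies i (trans (cong (vertex g) hsi≡)
                                        (trans (cong (λ x → vertex x (πH v)) g≡) (vertex-split v)))

  module FibreGame {cg : GG.Cops} {g : VG} (surG : GG.Surrounded cg g) where
    mutual
      fibreC : ∀ {hs h} → HG.CopWinC hs h → PG.CopWinC (formation cg (inFibre g hs)) (vertex g h)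
      fibreC (HG.surroundedC surH) = PG.surroundedC (surrounded-in-fibre surG surH)
      fibreC (HG.copMove hs' moves w) =
        PG.copMove _ (formation-moves (λ _ → inj₁ refl) (λ i → liftMoveH g (moves i))) (fibreR w)

      fibreR : ∀ {hs h} → HG.CopWinR hs h → PG.CopWinR (formation cg (inFibre g hs)) (vertex g h)
      fibreR (HG.surroundedR surH) = PG.surroundedR (surrounded-in-fibre surG surH)
      fibreR {hs} (HG.robberMoves w) = PG.robberMoves robber
        where
          robber : ∀ r' → PG.Move _ r' → ¬ PG.Occupied (formation cg (inFibre g hs)) r' →
                   PG.CopWinC (formation cg (inFibre g hs)) r'
          robber r' mv free with confined surG mv free
          ... | h' , refl , mvH = fibreC (w h' mvH λ (i , hsi≡) → free (free-occupies i (cong (vertex g) hsi≡)))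

  FibreWin : GG.Cops → VG → FreeCops → Set
  FibreWin cg g fc = ∀ h → ¬ PG.Occupied (formation cg fc) (vertex g h) → PG.CopWinC (formation cg fc) (vertex g h)

  fibreWin-at : ∀ {cg fc x} → FibreWin cg (πG x) fc → ¬ PG.Occupied (formation cg fc) x → PG.CopWinC (formation cg fc) x
  fibreWin-at {cg} {fc} {x} win free =
    subst (PG.CopWinC (formation cg fc)) (vertex-split x)
      (win (πH x) (λ o → free (subst (PG.Occupied (formation cg fc)) (vertex-split x) o)))

  robberTurn : ∀ {cg g fc} → GG.Surrounded cg g → FibreWin cg g fc → ∀ h → PG.CopWinR (formation cg fc) (vertex g h)
  robberTurn {cg} {g} {fc} surG win h = PG.robberMoves robber
    where
      robber : ∀ r' → PG.Move (vertex g h) r' → ¬ PG.Occupied (formation cg fc) r' → PG.CopWinC (formation cg fc) r'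
      robber r' mv free with confined surG mv free
      ... | h' , refl , _ = win h' free

  copTurn : ∀ {cg g fc fc'} → GG.Surrounded cg g → (∀ i → PG.Move (fc i) (fc' i)) →
            FibreWin cg g fc' → FibreWin cg g fc
  copTurn surG moves win h _ = PG.copMove _ (formation-moves (λ _ → inj₁ refl) moves) (robberTurn surG win h)

  -- Gathering: from any placement the free cops can walk to a FibreWin placement, one cop
  -- at a time along a walk in the connected graph G ∘ H.
  module Gathering (connected : ∀ x y → Reach (G ∘ₗ H) x y) {cg : GG.Cops} {g : VG}
                   (surG : GG.Surrounded cg g) (target : FreeCops) (targetWins : FibreWin cg g target) where

    fibreWin-resp : ∀ {fc fc'} → fc ≗ fc' → FibreWin cg g fc → FibreWin cg g fc'
    fibreWin-resp fc≗fc' = copTurn surG (λ i → inj₁ (sym (fc≗fc' i)))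

    stepOne : ∀ (i : Fin t) (fc : FreeCops) {x y} → Adj (G ∘ₗ H) x y →
              ∀ j → PG.Move (updateAt fc i (const x) j) (updateAt fc i (const y) j)
    stepOne i fc a j with j ≟ i
    ... | yes refl = subst₂ PG.Move (sym (updateAt-updates i fc)) (sym (updateAt-updates i fc)) (inj₂ a)
    ... | no j≢i = inj₁ (trans (updateAt-minimal j i fc j≢i) (sym (updateAt-minimal j i fc j≢i)))

    relocate : ∀ (i : Fin t) (fc : FreeCops) {x y} → Reach (G ∘ₗ H) x y →
               FibreWin cg g (updateAt fc i (const y)) → FibreWin cg g (updateAt fc i (const x))
    relocate i fc here win = win
    relocate i fc (step a p) win = copTurn surG (stepOne i fc a) (relocate i fc p win)

    gather : (l : List (Fin t)) (fc : FreeCops) → (∀ i → i ∉ l → fc i ≡ target i) → FibreWin cg g fc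
    gather [] fc placed = fibreWin-resp (λ i → sym (placed i λ ())) targetWins
    gather (i ∷ l) fc placed =
      fibreWin-resp (updateAt-id-local i fc refl)
        (relocate i fc (connected (fc i) (target i)) (gather l (updateAt fc i (const (target i))) placed′))
      where
        placed′ : ∀ j → j ∉ l → updateAt fc i (const (target i)) j ≡ target j
        placed′ j j∉l with j ≟ i
        ... | yes refl = updateAt-updates i fc
        ... | no j≢i = trans (updateAt-minimal j i fc j≢i) (placed j λ { (here j≡i) → j≢i j≡i ; (there j∈l) → j∉l j∈l })

    gatherAll : ∀ (fc : FreeCops) → FibreWin cg g fc
    gatherAll fc = gather (allFin t) fc (λ i i∉ → ⊥-elim (i∉ (∈-allFin i)))

  module ShadowGame (fc : FreeCops) (endgame : ∀ {cg g} → GG.Surrounded cg g → FibreWin cg g fc) where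
    mutual
      shadowC : ∀ {cg g} → GG.CopWinC cg g → FibreWin cg g fc
      shadowC (GG.surroundedC surG) = endgame surG
      shadowC (GG.copMove cg' moves w) h _ =
        PG.copMove (formation cg' fc) (formation-moves moves (λ _ → inj₁ refl)) (shadowR w h)

      shadowR : ∀ {cg g} → GG.CopWinR cg g → ∀ h → PG.CopWinR (formation cg fc) (vertex g h)
      shadowR (GG.surroundedR surG) h = robberTurn surG (endgame surG) h
      shadowR {cg} (GG.robberMoves w) h = PG.robberMoves λ r' mv free →
        fibreWin-at (shadowC (w (πG r') (projectMove mv) λ (j , cgj≡) → free (shadow-occupies j cgj≡))) free

  win : Connected G → Connected H → CopsWin G s → CopsWin H t → CopsWin (G ∘ₗ H) K
  win (g₀ , connG) (h₀ , connH) (cg₀ , winG) (hs₀ , winH) = formation cg₀ waiting , start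
    where
      waiting : FreeCops
      waiting _ = vertex g₀ h₀

      endgame : ∀ {cg g} → GG.Surrounded cg g → FibreWin cg g waiting
      endgame {g = g} surG = Gathering.gatherAll (product-connected connG connH) surG (inFibre g hs₀)
        (λ h free → FibreGame.fibreC surG (winH h λ (i , hsi≡) → free (free-occupies i (cong (vertex g) hsi≡))))
        waiting

      start : ∀ r → ¬ PG.Occupied (formation cg₀ waiting) r → PG.CopWinC (formation cg₀ waiting) r
      start r free = fibreWin-at (ShadowGame.shadowC waiting endgame
                                   (winG (πG r) λ (j , cgj≡) → free (shadow-occupies j cgj≡))) free

theorem22 : (G H : Graph) → Connected G → Connected H →
    (s t : ℕ) → IsSurroundingCopNumber G s → IsSurroundingCopNumber H t →
    Σ ℕ (λ u → IsSurroundingCopNumber (G ∘ₗ H) u × (u ≤ s * n H + t))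
theorem22 G H connG connH s t (_ , winG , _) (1≤t , winH , _)
  with leastWitness (λ k → (1 ≤? k) ×-dec Decision.copsWin? (G ∘ₗ H) k) (s * n H + t)
                    (≤-trans 1≤t (m≤n+m t (s * n H)) , Strategy.win G H s t connG connH winG winH)
... | u , u≤ , (1≤u , winU) , below = u , (1≤u , winU , λ k 1≤k k<u winK → below k k<u (1≤k , winK)) , u≤
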